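{- For every non-empty string $w$, $z(w) - 1 + \sigma_w \le g^\ast(w)$, where $z(w)$ is the number of phrases of the LZ-factorization of $w$, $\sigma_w$ is the number of distinct symbols occurring in $w$, and $g^\ast(w)$ is the size of a smallest grammar of $w$.
   Context: A grammar of $w$ is a straight-line program: a context-free grammar in Chomsky normal form with productions $X_i\to\alpha$ ($\alpha$ terminal) or $X_i\to X_jX_k$ ($j,k<i$) deriving exactly $w$; its size is its number of productions. A factorization of $w$ is a sequence $(s_1,\dots,s_m)$ of non-empty strings with $w=s_1\cdots s_m$. Phrase $s_i$ is greedy if either $s_i$ is a single symbol occurring for the first time in $s_1\cdots s_i$, or $s_i$ is the longest prefix of $s_i\cdots s_m$ that occurs as a substring of $s_1\cdots s_{i-1}$. The LZ-factorization of $w$ is the factorization in which all phrases are greedy; $z(w)$ is its number of phrases. -}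

module Defs where

open import Data.Nat using (ℕ; zero; suc; _<_)
open import Data.Fin using (Fin)
open import Data.List using (List; []; _∷_; _++_; [_]; concat; length; deduplicate)
open import Data.List.Membership.Propositional using (_∉_)
open import Data.Vec using (Vec; lookup; _∷ʳ_; last)
open import Data.Product using (Σ; ∃; _×_; _,_)
open import Data.Sum using (_⊎_)
open import Relation.Nullary using (¬_)
open import Relation.Binary.Definitions using (DecidableEquality)
open import Relation.Binary.PropositionalEquality using (_≡_; _≢_)

Substring : {A : Set} → List A → List A → Set
Substring {A} u v = Σ (List A) λ x → Σ (List A) λ y → x ++ (u ++ y) ≡ v

Prefix : {A : Set} → List A → List A → Set
Prefix {A} t u = Σ (List A) λ y → t ++ y ≡ u

-- Greedy p s r : phrase s is greedy, where p = s_1⋯s_{i-1} and r = s_{i+1}⋯s_m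
Greedy : {A : Set} → List A → List A → List A → Set
Greedy {A} p s r =
  (Σ A λ a → (s ≡ [ a ]) × (a ∉ p))
  ⊎ ((s ≢ []) × Substring s p
      × (∀ t → Prefix t (s ++ r) → length s < length t → ¬ Substring t p))

AllGreedy : {A : Set} → List A → List (List A) → Set
AllGreedy p [] = Data.Unit.⊤ where import Data.Unit
AllGreedy p (s ∷ fs) = Greedy p s (concat fs) × AllGreedy (p ++ s) fs

-- fs is the LZ-factorization of w (greedy phrases are non-empty by definition)
IsLZFactorization : {A : Set} → List A → List (List A) → Set
IsLZFactorization w fs = (concat fs ≡ w) × AllGreedy [] fs

σ : {A : Set} → DecidableEquality A → List A → ℕ
σ _≟_ w = length (deduplicate _≟_ w)

-- Straight-line programs.  A production X_i → α or X_i → X_j X_k with j,k < i.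
data Rule (A : Set) (i : ℕ) : Set where
  term : A → Rule A i
  pair : Fin i → Fin i → Rule A i

data SLP (A : Set) : ℕ → Set where
  []  : SLP A zero
  _▷_ : {n : ℕ} → SLP A n → Rule A n → SLP A (suc n)

expansions : {A : Set} {n : ℕ} → SLP A n → Vec (List A) n
expansions [] = Vec.[]
  where import Data.Vec as Vec
expansions (G ▷ term a) = expansions G ∷ʳ [ a ]
expansions (G ▷ pair j k) = expansions G ∷ʳ (lookup (expansions G) j ++ lookup (expansions G) k)

-- G is a grammar of w: its start symbol (the last production) derives exactly w.
-- Its size is n, the number of productions.
IsGrammarOf : {A : Set} {n : ℕ} → SLP A n → List A → Set
IsGrammarOf {n = zero} G w = Data.Empty.⊥ where import Data.Empty
IsGrammarOf {n = suc m} G w = last (expansions G) ≡ w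

-- Call a factorization admissible if each phrase is a single symbol or a
-- substring of the text preceding it.  The LZ-factorization has the fewest
-- phrases among admissible factorizations, because every greedy phrase
-- reaches at least as far as the admissible phrase covering its start.
-- Conversely, unfold the start symbol of a grammar depth first, left to
-- right, cutting the parse tree at every nonterminal met a second time (its
-- expansion then occurs earlier).  The leaves of the pruned tree form an
-- admissible factorization with one phrase more than there are first visits
-- of binary productions, while the first visits of terminal productions
-- supply all σ symbols of w; both kinds together are at most n.
module Submission where

open import Defs
open import Data.Nat using (ℕ; suc; _+_; _∸_; _≤_; _<_; z≤n; s≤s; s≤s⁻¹; _≤?_)
open import Data.Nat.Properties
  using ( ≤-refl; ≤-trans; ≤-reflexive; ≤-total; <-≤-trans; ≤-<-trans; <⇒≤; n≮n; m≤n⇒m≤1+n; m≤n+m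
        ; +-mono-≤; ≰⇒>; module ≤-Reasoning)
open import Data.Fin as Fin using (Fin; toℕ; fromℕ; inject₁)
  renaming (_≤_ to _≤ᶠ_; _<_ to _<ᶠ_)
open import Data.Fin.Properties using (_≟_; toℕ-fromℕ; toℕ-inject₁; inject₁ℕ<)
open import Data.Fin.Induction using (<-wellFounded)
open import Data.Fin.Relation.Unary.Top using (view; ‵fromℕ; ‵inj₁)
open import Data.List using (List; []; _∷_; _++_; [_]; concat; length)
open import Data.List.Properties
  using (++-assoc; ++-identityʳ; ++-conicalˡ; ++-conicalʳ; length-++; concat-++; length-tabulate; ∷-injective)
open import Data.List.Membership.Propositional using (_∈_; _∉_)
open import Data.List.Membership.Propositional.Properties
  using (∈-∃++; ∈-allFin; ∈-++⁺ˡ; ∈-++⁺ʳ; ∈-++⁻)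
open import Data.List.Relation.Unary.Any using (here; there; any?)
open import Data.List.Relation.Unary.Any.Properties using (deduplicate⁻)
open import Data.List.Relation.Unary.All as All using ()
open import Data.List.Relation.Unary.All.Properties.Core using (¬Any⇒All¬)
open import Data.List.Relation.Unary.Unique.Propositional using (Unique)
open import Data.List.Relation.Unary.AllPairs using ([]; _∷_)
open import Data.List.Relation.Unary.Unique.DecPropositional.Properties using (deduplicate-!)
open import Data.Vec as Vec using (Vec; lookup; _∷ʳ_; last)
open import Data.Vec.Properties using (last-∷ʳ)
open import Data.Nat.Tactic.RingSolver using (solve-∀)
open import Data.Product using (Σ; _×_; _,_)
open import Data.Sum using (_⊎_; inj₁; inj₂; [_,_]′)
open import Data.Empty using (⊥-elim)
open import Function using (_∘′_)
open import Data.Unit using (⊤; tt)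
open import Induction.WellFounded using (Acc; acc)
open import Relation.Nullary using (¬_; yes; no)
open import Relation.Binary.Definitions using (DecidableEquality)
open import Relation.Binary.PropositionalEquality
  using (_≡_; _≢_; refl; sym; trans; cong; cong₂; subst; subst₂; module ≡-Reasoning)

module _ {A : Set} where

  ++-split-≤ : (a c : List A) {b d : List A} → a ++ b ≡ c ++ d → length a ≤ length c →
    Σ (List A) λ z → (c ≡ a ++ z) × (b ≡ z ++ d)
  ++-split-≤ [] c eq _ = c , refl , eq
  ++-split-≤ (x ∷ a) (y ∷ c) eq (s≤s |a|≤|c|) with ∷-injective eq
  ... | refl , eq′ with ++-split-≤ a c eq′ |a|≤|c|
  ... | z , refl , b≡ = z , refl , b≡

  Substring-++ʳ : {u v : List A} (r : List A) → Substring u v → Substring u (v ++ r)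
  Substring-++ʳ {u} r (x , y , refl) =
    x , y ++ r , trans (cong (x ++_) (sym (++-assoc u y r))) (sym (++-assoc x (u ++ y) r))

  Substring-suffix : (a b : List A) {v : List A} → Substring (a ++ b) v → Substring b v
  Substring-suffix a b (x , y , refl) =
    x ++ a , y , trans (++-assoc x a (b ++ y)) (cong (x ++_) (sym (++-assoc a b y)))

  Substring-end : (v u : List A) → Substring u (v ++ u)
  Substring-end v u = v , [] , cong (v ++_) (++-identityʳ u)

  ∈-Substring : {c : A} {u v : List A} → c ∈ u → Substring u v → c ∈ v
  ∈-Substring c∈u (x , y , refl) = ∈-++⁺ʳ x (∈-++⁺ˡ c∈u)

  ∈-++-∷⁻ : (xs : List A) {c x : A} {ys : List A} → c ∈ xs ++ x ∷ ys → c ≢ x → c ∈ xs ++ ys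
  ∈-++-∷⁻ [] (here c≡x) c≢x = ⊥-elim (c≢x c≡x)
  ∈-++-∷⁻ [] (there c∈) _ = c∈
  ∈-++-∷⁻ (_ ∷ xs) (here c≡x) _ = here c≡x
  ∈-++-∷⁻ (_ ∷ xs) (there c∈) c≢x = there (∈-++-∷⁻ xs c∈ c≢x)

  length-++-∷ : (xs ys : List A) (x : A) → length (xs ++ x ∷ ys) ≡ suc (length (xs ++ ys))
  length-++-∷ [] ys x = refl
  length-++-∷ (_ ∷ xs) ys x = cong suc (length-++-∷ xs ys x)

  Unique-⊆⇒length≤ : {xs ys : List A} → Unique xs → (∀ {x} → x ∈ xs → x ∈ ys) →
    length xs ≤ length ys
  Unique-⊆⇒length≤ {[]} _ _ = z≤n
  Unique-⊆⇒length≤ {x ∷ xs} (x∉xs ∷ !xs) xs⊆ys with ∈-∃++ (xs⊆ys (here refl))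
  ... | ys₁ , ys₂ , refl =
    ≤-trans (s≤s (Unique-⊆⇒length≤ !xs xs⊆ys₁ys₂)) (≤-reflexive (sym (length-++-∷ ys₁ ys₂ x)))
    where
      xs⊆ys₁ys₂ : ∀ {c} → c ∈ xs → c ∈ ys₁ ++ ys₂
      xs⊆ys₁ys₂ c∈ = ∈-++-∷⁻ ys₁ (xs⊆ys (there c∈)) (λ c≡x → All.lookup x∉xs c∈ (sym c≡x))

  Admissible : List A → List A → Set
  Admissible p t = (Σ A λ a → t ≡ [ a ]) ⊎ Substring t p

  AllAdmissible : List A → List (List A) → Set
  AllAdmissible p [] = ⊤
  AllAdmissible p (t ∷ gs) = Admissible p t × AllAdmissible (p ++ t) gs

  AllAdmissible-++ : (p : List A) (gs hs : List (List A)) → AllAdmissible p gs →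
    AllAdmissible (p ++ concat gs) hs → AllAdmissible p (gs ++ hs)
  AllAdmissible-++ p [] hs _ hs-adm = subst (λ q → AllAdmissible q hs) (++-identityʳ p) hs-adm
  AllAdmissible-++ p (t ∷ gs) hs (t-adm , gs-adm) hs-adm =
    t-adm , AllAdmissible-++ (p ++ t) gs hs gs-adm
              (subst (λ q → AllAdmissible q hs) (sym (++-assoc p t (concat gs))) hs-adm)

  ≢[]⇒0<length : {s : List A} → s ≢ [] → 0 < length s
  ≢[]⇒0<length {[]} s≢[] = ⊥-elim (s≢[] refl)
  ≢[]⇒0<length {_ ∷ _} _ = s≤s z≤n

  greedy-nonempty : {p s r : List A} → Greedy p s r → s ≢ []
  greedy-nonempty (inj₁ (_ , refl , _)) ()
  greedy-nonempty (inj₂ (s≢[] , _)) = s≢[]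

  greedy-maximal : {p s r t : List A} → Greedy p s r →
    Prefix t (s ++ r) → length s < length t → ¬ Substring t p
  greedy-maximal (inj₂ (_ , _ , maximal)) t⊑sr |s|<|t| = maximal _ t⊑sr |s|<|t|
  greedy-maximal {t = []} (inj₁ (_ , refl , _)) _ ()
  greedy-maximal {t = _ ∷ _} (inj₁ (_ , refl , b∉p)) (_ , eq) _ t⊑p with ∷-injective eq
  ... | refl , _ = b∉p (∈-Substring (here refl) t⊑p)

  admissible-suffix : {p x y : List A} → Admissible p (x ++ y) → 1 < length y → Substring y (p ++ x)
  admissible-suffix {x = x} {y} (inj₂ xy⊑p) _ = Substring-++ʳ x (Substring-suffix x y xy⊑p)
  admissible-suffix {x = x} {y} (inj₁ (_ , xy≡[a])) 1<|y| = ⊥-elim (n≮n 1 (<-≤-trans 1<|y| |y|≤1))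
    where
      |y|≤1 : length y ≤ 1
      |y|≤1 = ≤-trans (m≤n+m (length y) (length x))
                (≤-reflexive (trans (sym (length-++ x)) (cong length xy≡[a])))

  greedy-reaches : {p x y s r : List A} → Admissible p (x ++ y) → Greedy (p ++ x) s r →
    Prefix y (s ++ r) → length y ≤ length s
  greedy-reaches {y = y} {s} xy-adm greedy y⊑sr with length y ≤? length s
  ... | yes |y|≤|s| = |y|≤|s|
  ... | no |y|≰|s| = ⊥-elim (greedy-maximal greedy y⊑sr |s|<|y| (admissible-suffix xy-adm 1<|y|))
    where
      |s|<|y| : length s < length y
      |s|<|y| = ≰⇒> |y|≰|s|
      1<|y| : 1 < length y
      1<|y| = ≤-<-trans (≢[]⇒0<length (greedy-nonempty greedy)) |s|<|y|

  -- The LZ-phrases still to come start |x| symbols after the admissible ones.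
  lz-optimal : (p x : List A) (fs gs : List (List A)) → AllGreedy (p ++ x) fs → AllAdmissible p gs →
    x ++ concat fs ≡ concat gs → length fs ≤ length gs
  lz-optimal p x [] gs _ _ _ = z≤n
  lz-optimal p x (s ∷ fs) [] (greedy , _) _ eq =
    ⊥-elim (greedy-nonempty greedy (++-conicalˡ s _ (++-conicalʳ x _ eq)))
  lz-optimal p x (s ∷ fs) (t ∷ gs) (s-greedy , fs-greedy) (t-adm , gs-adm) eq
    with ≤-total (length t) (length x)
  ... | inj₁ |t|≤|x| with ++-split-≤ t x (sym eq) |t|≤|x|
  ...   | z , refl , gs≡ =
    m≤n⇒m≤1+n (lz-optimal (p ++ t) z (s ∷ fs) gs
      (subst (λ q → AllGreedy q (s ∷ fs)) (sym (++-assoc p t z)) (s-greedy , fs-greedy)) gs-adm (sym gs≡))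
  lz-optimal p x (s ∷ fs) (t ∷ gs) (s-greedy , fs-greedy) (t-adm , gs-adm) eq
      | inj₂ |x|≤|t| with ++-split-≤ x t eq |x|≤|t|
  ...   | y , refl , sfs≡ with ++-split-≤ y s (sym sfs≡) (greedy-reaches t-adm s-greedy (concat gs , sym sfs≡))
  ...     | z , refl , gs≡ =
    s≤s (lz-optimal (p ++ (x ++ y)) z fs gs (subst (λ q → AllGreedy q fs) reassoc fs-greedy) gs-adm (sym gs≡))
    where
      reassoc : (p ++ x) ++ (y ++ z) ≡ (p ++ (x ++ y)) ++ z
      reassoc = begin
        (p ++ x) ++ (y ++ z)   ≡⟨ ++-assoc p x (y ++ z) ⟩
        p ++ (x ++ (y ++ z))   ≡⟨ cong (p ++_) (++-assoc x y z) ⟨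
        p ++ ((x ++ y) ++ z)   ≡⟨ ++-assoc p (x ++ y) z ⟨
        (p ++ (x ++ y)) ++ z   ∎
        where open ≡-Reasoning

Unique-Fin⇒length≤ : {n : ℕ} {xs : List (Fin n)} → Unique xs → length xs ≤ n
Unique-Fin⇒length≤ {n} !xs =
  ≤-trans (Unique-⊆⇒length≤ !xs (λ {i} _ → ∈-allFin i))
    (≤-reflexive (length-tabulate {n = n} (λ i → i)))

σ≤length : {A : Set} (_≟_ : DecidableEquality A) {w syms : List A} →
  (∀ {c} → c ∈ w → c ∈ syms) → σ _≟_ w ≤ length syms
σ≤length _≟_ {w} w⊆syms =
  Unique-⊆⇒length≤ (deduplicate-! _≟_ w) (λ c∈ → w⊆syms (deduplicate⁻ _≟_ c∈))

merge-counts : ∀ p₁ p₂ s₁ s₂ v₁ v₂ → p₁ + s₁ ≤ suc v₁ → p₂ + s₂ ≤ suc v₂ →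
  (p₁ + p₂) + (s₂ + s₁) ≤ suc (suc (v₂ + v₁))
merge-counts p₁ p₂ s₁ s₂ v₁ v₂ c₁ c₂ =
  subst₂ _≤_ (regroup p₁ p₂ s₁ s₂) (shift v₁ v₂) (+-mono-≤ c₁ c₂)
  where
    regroup : ∀ p₁ p₂ s₁ s₂ → (p₁ + s₁) + (p₂ + s₂) ≡ (p₁ + p₂) + (s₂ + s₁)
    regroup = solve-∀
    shift : ∀ v₁ v₂ → suc v₁ + suc v₂ ≡ suc (suc (v₂ + v₁))
    shift = solve-∀

data Production {A : Set} {n : ℕ} (E : Fin n → List A) (i : Fin n) : Set where
  terminal : (a : A) → E i ≡ [ a ] → Production E i
  binary : (j k : Fin n) → j <ᶠ i → k <ᶠ i → E i ≡ E j ++ E k → Production E i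

module Traversal {A : Set} {n : ℕ} (E : Fin n → List A) (production : ∀ i → Production E i) where

  -- L lists the nonterminals visited so far, Q is the text produced so far
  -- and T the symbols of the visited terminal productions.
  record Invariant (L : List (Fin n)) (Q T : List A) : Set where
    field
      unique : Unique L
      occur : ∀ {Y} → Y ∈ L → Substring (E Y) Q
      cover : ∀ {c} → c ∈ Q → c ∈ T
  open Invariant

  record Parse (X : Fin n) (L : List (Fin n)) (Q T : List A) : Set where
    field
      phrases : List (List A)
      visited : List (Fin n)
      symbols : List A
      concat-phrases : concat phrases ≡ E X
      admissible : AllAdmissible Q phrases
      invariant : Invariant (visited ++ L) (Q ++ E X) (symbols ++ T)
      visited≤ : ∀ {Y} → Y ∈ visited → Y ≤ᶠ X
      count : length phrases + length symbols ≤ suc (length visited)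
  open Parse

  empty : Invariant [] [] []
  empty = record { unique = [] ; occur = λ () ; cover = λ () }

  extend : ∀ {L Q T T′ u} → Invariant L Q T →
    (∀ {c} → c ∈ T → c ∈ T′) → (∀ {c} → c ∈ u → c ∈ T′) → Invariant L (Q ++ u) T′
  extend {Q = Q} {u = u} inv T⊆T′ u⊆T′ = record
    { unique = unique inv
    ; occur = λ Y∈L → Substring-++ʳ u (occur inv Y∈L)
    ; cover = λ c∈Qu → [ (λ c∈Q → T⊆T′ (cover inv c∈Q)) , u⊆T′ ]′ (∈-++⁻ Q c∈Qu)
    }

  visit : ∀ {L Q T X} → Invariant L Q T → X ∉ L → Substring (E X) Q → Invariant (X ∷ L) Q T
  visit inv X∉L EX⊑Q = record
    { unique = ¬Any⇒All¬ _ X∉L ∷ unique inv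
    ; occur = λ { (here refl) → EX⊑Q ; (there Y∈L) → occur inv Y∈L }
    ; cover = cover inv
    }

  traverse : (X : Fin n) → Acc _<ᶠ_ X → ∀ {L Q T} → Invariant L Q T → Parse X L Q T
  traverse X (acc rec) {L} {Q} {T} inv with any? (X ≟_) L
  ... | yes X∈L = record
    { phrases = [ E X ] ; visited = [] ; symbols = []
    ; concat-phrases = ++-identityʳ (E X)
    ; admissible = inj₂ (occur inv X∈L) , tt
    ; invariant = extend inv (λ c∈T → c∈T) (λ c∈EX → cover inv (∈-Substring c∈EX (occur inv X∈L)))
    ; visited≤ = λ ()
    ; count = ≤-refl
    }
  ... | no X∉L with production X
  ...   | terminal a EX≡[a] = record
    { phrases = [ [ a ] ] ; visited = [ X ] ; symbols = [ a ]
    ; concat-phrases = sym EX≡[a]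
    ; admissible = inj₁ (a , refl) , tt
    ; invariant = visit (extend inv there EX⊆aT) X∉L (Substring-end Q (E X))
    ; visited≤ = λ { (here refl) → ≤-refl }
    ; count = ≤-refl
    }
    where
      EX⊆aT : ∀ {c} → c ∈ E X → c ∈ a ∷ T
      EX⊆aT c∈EX with subst (_ ∈_) EX≡[a] c∈EX
      ... | here c≡a = here c≡a
  ...   | binary Y Z Y<X Z<X EX≡EYEZ = record
    { phrases = phrases r₁ ++ phrases r₂
    ; visited = X ∷ visited r₂ ++ visited r₁
    ; symbols = symbols r₂ ++ symbols r₁
    ; concat-phrases = begin
        concat (phrases r₁ ++ phrases r₂)            ≡⟨ concat-++ (phrases r₁) (phrases r₂) ⟨
        concat (phrases r₁) ++ concat (phrases r₂)   ≡⟨ cong₂ _++_ (concat-phrases r₁) (concat-phrases r₂) ⟩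
        E Y ++ E Z                                   ≡⟨ EX≡EYEZ ⟨
        E X                                          ∎
    ; admissible = AllAdmissible-++ Q (phrases r₁) (phrases r₂) (admissible r₁)
        (subst (λ u → AllAdmissible (Q ++ u) (phrases r₂)) (sym (concat-phrases r₁)) (admissible r₂))
    ; invariant = visit invariant₂ (λ X∈ → [ (λ X∈v → n≮n _ (below X∈v)) , X∉L ]′ (∈-++⁻ _ X∈))
        (Substring-end Q (E X))
    ; visited≤ = λ { (here refl) → ≤-refl ; (there W∈) → <⇒≤ (below W∈) }
    ; count = subst₂ _≤_
        (sym (cong₂ _+_ (length-++ (phrases r₁)) (length-++ (symbols r₂))))
        (cong (suc ∘′ suc) (sym (length-++ (visited r₂))))
        (merge-counts (length (phrases r₁)) (length (phrases r₂)) (length (symbols r₁))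
           (length (symbols r₂)) (length (visited r₁)) (length (visited r₂)) (count r₁) (count r₂))
    }
    where
      open ≡-Reasoning
      r₁ : Parse Y L Q T
      r₁ = traverse Y (rec Y<X) inv
      r₂ : Parse Z (visited r₁ ++ L) (Q ++ E Y) (symbols r₁ ++ T)
      r₂ = traverse Z (rec Z<X) (invariant r₁)
      below : ∀ {W} → W ∈ visited r₂ ++ visited r₁ → W <ᶠ X
      below W∈ = [ (λ W∈₂ → ≤-<-trans (visited≤ r₂ W∈₂) Z<X)
                 , (λ W∈₁ → ≤-<-trans (visited≤ r₁ W∈₁) Y<X) ]′ (∈-++⁻ (visited r₂) W∈)
      invariant₂ : Invariant ((visited r₂ ++ visited r₁) ++ L) (Q ++ E X) ((symbols r₂ ++ symbols r₁) ++ T)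
      invariant₂ =
        subst₂ (λ L′ T′ → Invariant L′ (Q ++ E X) T′)
          (sym (++-assoc (visited r₂) (visited r₁) L)) (sym (++-assoc (symbols r₂) (symbols r₁) T))
          (subst (λ Q′ → Invariant (visited r₂ ++ visited r₁ ++ L) Q′ (symbols r₂ ++ symbols r₁ ++ T))
            (trans (++-assoc Q (E Y) (E Z)) (cong (Q ++_) (sym EX≡EYEZ))) (invariant r₂))

lookup-∷ʳ-inject₁ : {B : Set} {n : ℕ} (v : Vec B n) (x : B) (j : Fin n) →
  lookup (v ∷ʳ x) (inject₁ j) ≡ lookup v j
lookup-∷ʳ-inject₁ (_ Vec.∷ _) x Fin.zero = refl
lookup-∷ʳ-inject₁ (_ Vec.∷ v) x (Fin.suc j) = lookup-∷ʳ-inject₁ v x j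

lookup-∷ʳ-fromℕ : {B : Set} {n : ℕ} (v : Vec B n) (x : B) → lookup (v ∷ʳ x) (fromℕ n) ≡ x
lookup-∷ʳ-fromℕ Vec.[] x = refl
lookup-∷ʳ-fromℕ (_ Vec.∷ v) x = lookup-∷ʳ-fromℕ v x

inject₁-mono-< : {n : ℕ} {j i : Fin n} → j <ᶠ i → inject₁ j <ᶠ inject₁ i
inject₁-mono-< {j = j} {i} = subst₂ _<_ (sym (toℕ-inject₁ j)) (sym (toℕ-inject₁ i))

inject₁<fromℕ : {n : ℕ} (j : Fin n) → inject₁ j <ᶠ fromℕ n
inject₁<fromℕ {n} j = subst (toℕ (inject₁ j) <_) (sym (toℕ-fromℕ n)) (inject₁ℕ< j)

Production-inject₁ : {A : Set} {n : ℕ} {E : Fin n → List A} {E′ : Fin (suc n) → List A} {i : Fin n} →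
  (∀ j → E′ (inject₁ j) ≡ E j) → Production E i → Production E′ (inject₁ i)
Production-inject₁ {i = i} E′≡E (terminal a Ei≡[a]) = terminal a (trans (E′≡E i) Ei≡[a])
Production-inject₁ {i = i} E′≡E (binary j k j<i k<i Ei≡EjEk) =
  binary (inject₁ j) (inject₁ k) (inject₁-mono-< j<i) (inject₁-mono-< k<i)
    (trans (E′≡E i) (trans Ei≡EjEk (sym (cong₂ _++_ (E′≡E j) (E′≡E k)))))

module _ {A : Set} where

  rhs : {n : ℕ} → SLP A n → Rule A n → List A
  rhs G (term a) = [ a ]
  rhs G (pair j k) = lookup (expansions G) j ++ lookup (expansions G) k

  expansions-▷ : {n : ℕ} (G : SLP A n) (r : Rule A n) → expansions (G ▷ r) ≡ expansions G ∷ʳ rhs G r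
  expansions-▷ G (term a) = refl
  expansions-▷ G (pair j k) = refl

  lookup-expansions-inject₁ : {n : ℕ} (G : SLP A n) (r : Rule A n) (j : Fin n) →
    lookup (expansions (G ▷ r)) (inject₁ j) ≡ lookup (expansions G) j
  lookup-expansions-inject₁ G r j =
    trans (cong (λ v → lookup v (inject₁ j)) (expansions-▷ G r))
      (lookup-∷ʳ-inject₁ (expansions G) (rhs G r) j)

  lookup-expansions-fromℕ : {n : ℕ} (G : SLP A n) (r : Rule A n) →
    lookup (expansions (G ▷ r)) (fromℕ n) ≡ rhs G r
  lookup-expansions-fromℕ G r =
    trans (cong (λ v → lookup v (fromℕ _)) (expansions-▷ G r)) (lookup-∷ʳ-fromℕ (expansions G) (rhs G r))

  last-expansions : {n : ℕ} (G : SLP A n) (r : Rule A n) → last (expansions (G ▷ r)) ≡ rhs G r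
  last-expansions G r = trans (cong last (expansions-▷ G r)) (last-∷ʳ (rhs G r) (expansions G))

  production : {n : ℕ} (G : SLP A n) (i : Fin n) → Production (lookup (expansions G)) i
  production (G ▷ r) i with view i
  production (G ▷ term a) _ | ‵fromℕ = terminal a (lookup-expansions-fromℕ G (term a))
  production (G ▷ pair j k) _ | ‵fromℕ =
    binary (inject₁ j) (inject₁ k) (inject₁<fromℕ j) (inject₁<fromℕ k)
      (trans (lookup-expansions-fromℕ G (pair j k))
        (sym (cong₂ _++_ (lookup-expansions-inject₁ G (pair j k) j)
                         (lookup-expansions-inject₁ G (pair j k) k))))
  production (G ▷ r) _ | ‵inj₁ {i = i} _ =
    Production-inject₁ (lookup-expansions-inject₁ G r) (production G i)

  grammar⇒admissible-factorization : {n : ℕ} (G : SLP A n) {w : List A} → IsGrammarOf G w →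
    Σ (List (List A)) λ gs → Σ (List A) λ syms →
      (concat gs ≡ w) × AllAdmissible [] gs × (∀ {c} → c ∈ w → c ∈ syms) ×
      (length gs + length syms ≤ suc n)
  grammar⇒admissible-factorization [] ()
  grammar⇒admissible-factorization {suc m} (G ▷ r) {w} G→w =
    phrases , symbols , trans concat-phrases root≡w , admissible , w⊆symbols ,
    ≤-trans count (s≤s (Unique-Fin⇒length≤ (subst Unique (++-identityʳ visited) (unique invariant))))
    where
      E : Fin (suc m) → List A
      E = lookup (expansions (G ▷ r))
      open Traversal E (production (G ▷ r))
      open Invariant
      root≡w : E (fromℕ m) ≡ w
      root≡w = trans (lookup-expansions-fromℕ G r) (trans (sym (last-expansions G r)) G→w)
      open Parse (traverse (fromℕ m) (<-wellFounded (fromℕ m)) empty)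
      w⊆symbols : ∀ {c} → c ∈ w → c ∈ symbols
      w⊆symbols c∈w =
        subst (_ ∈_) (++-identityʳ symbols) (cover invariant (subst (_ ∈_) (sym root≡w) c∈w))

theorem1 : {A : Set} (_≟_ : DecidableEquality A) (w : List A) → w ≢ []
    → (fs : List (List A)) → IsLZFactorization w fs
    → {n : ℕ} (G : SLP A n) → IsGrammarOf G w
    → (length fs ∸ 1) + σ _≟_ w ≤ n
theorem1 _≟_ w w≢[] [] (refl , _) G _ = ⊥-elim (w≢[] refl)
theorem1 _≟_ w w≢[] (s ∷ fs) (concat-fs≡w , greedy) {n} G G→w
  with gs , syms , concat-gs≡w , admissible , w⊆syms , count ← grammar⇒admissible-factorization G G→w =
  s≤s⁻¹ (begin
    length (s ∷ fs) + σ _≟_ w   ≤⟨ +-mono-≤ lz≤gs (σ≤length _≟_ w⊆syms) ⟩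
    length gs + length syms     ≤⟨ count ⟩
    suc n                       ∎)
  where
    open ≤-Reasoning
    lz≤gs : length (s ∷ fs) ≤ length gs
    lz≤gs = lz-optimal [] [] (s ∷ fs) gs greedy admissible (trans concat-fs≡w (sym concat-gs≡w))
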